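{- Let $G_1$ be a pseudo strongly regular graph with parameters $(n_1,k_1,\mu_1)$ and $G_2$ a pseudo strongly regular graph with parameters $(n_2,k_2,\mu_2)$. Then the composition $G_1[G_2]$ is pseudo strongly regular if and only if $\mu_1=k_1$ and $\mu_2=0$ (in this case, $G_2$ is a disjoint union of complete graphs).
   Context: All graphs are finite and simple. A graph on $n$ vertices is pseudo strongly regular with parameters $(n,k,\mu)$ if every vertex has exactly $k$ neighbours and any two distinct non-adjacent vertices have exactly $\mu$ common neighbours. The composition (wreath, lexicographic product) $G_1[G_2]$ has vertex set $V(G_1)\times V(G_2)$, with $(u_1,v_1)$ adjacent to $(u_2,v_2)$ precisely when either $u_1u_2\in E(G_1)$, or $u_1=u_2$ and $v_1v_2\in E(G_2)$. -}

module Defs where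

open import Data.Nat using (ℕ; zero; suc; _+_; _*_)
open import Data.Bool using (Bool; true; false; _∧_; _∨_; if_then_else_)
import Data.Fin
open import Data.Fin using (Fin; remQuot; _≟_)
open import Data.Empty using (⊥-elim)
open import Data.Product using (_×_; _,_; proj₁; proj₂; Σ; ∃)
open import Relation.Nullary using (¬_; yes; no)
open import Relation.Nullary.Decidable using (⌊_⌋)
open import Relation.Binary.PropositionalEquality using (_≡_; _≢_; refl; sym; cong; cong₂)

record Graph (n : ℕ) : Set where
  field
    adj    : Fin n → Fin n → Bool
    adj-sym    : ∀ u v → adj u v ≡ adj v u
    adj-irrefl : ∀ u → adj u u ≡ false
open Graph public

count : ∀ {n} → (Fin n → Bool) → ℕ
count {zero}  f = 0
count {suc n} f = (if f Data.Fin.zero then 1 else 0) + count (λ i → f (Data.Fin.suc i))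

degree : ∀ {n} → Graph n → Fin n → ℕ
degree G u = count (adj G u)

commonNeighbours : ∀ {n} → Graph n → Fin n → Fin n → ℕ
commonNeighbours G u v = count (λ w → adj G u w ∧ adj G v w)

IsPSR : ∀ {n} → Graph n → ℕ → ℕ → Set
IsPSR {n} G k μ =
  (∀ u → degree G u ≡ k) ×
  (∀ u v → u ≢ v → adj G u v ≡ false → commonNeighbours G u v ≡ μ)

IsPSRGraph : ∀ {n} → Graph n → Set
IsPSRGraph G = Σ ℕ λ k → Σ ℕ λ μ → IsPSR G k μ

NonComplete : ∀ {n} → Graph n → Set
NonComplete {n} G = Σ (Fin n) λ u → Σ (Fin n) λ v → u ≢ v × adj G u v ≡ false

-- Composition G₁[G₂] on Fin (n₁ * n₂), vertex x ↔ remQuot n₂ x ∈ Fin n₁ × Fin n₂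
private
  eqb : ∀ {n} → Fin n → Fin n → Bool
  eqb a b = ⌊ a ≟ b ⌋

  eqb-sym : ∀ {n} (a b : Fin n) → eqb a b ≡ eqb b a
  eqb-sym a b with a ≟ b | b ≟ a
  ... | yes _ | yes _ = refl
  ... | no _  | no _  = refl
  ... | yes p | no q  = ⊥-elim (q (sym p))
  ... | no p  | yes q = ⊥-elim (p (sym q))

  eqb-refl : ∀ {n} (a : Fin n) → eqb a a ≡ true
  eqb-refl a with a ≟ a
  ... | yes _ = refl
  ... | no p  = ⊥-elim (p refl)

  compAdj : ∀ {n₁ n₂} → Graph n₁ → Graph n₂ → Fin n₁ × Fin n₂ → Fin n₁ × Fin n₂ → Bool
  compAdj G₁ G₂ (u₁ , v₁) (u₂ , v₂) = adj G₁ u₁ u₂ ∨ (eqb u₁ u₂ ∧ adj G₂ v₁ v₂)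

  compAdj-sym : ∀ {n₁ n₂} (G₁ : Graph n₁) (G₂ : Graph n₂) p q → compAdj G₁ G₂ p q ≡ compAdj G₁ G₂ q p
  compAdj-sym G₁ G₂ (u₁ , v₁) (u₂ , v₂) =
    cong₂ _∨_ (adj-sym G₁ u₁ u₂) (cong₂ _∧_ (eqb-sym u₁ u₂) (adj-sym G₂ v₁ v₂))

  compAdj-irrefl : ∀ {n₁ n₂} (G₁ : Graph n₁) (G₂ : Graph n₂) p → compAdj G₁ G₂ p p ≡ false
  compAdj-irrefl G₁ G₂ (u , v) rewrite adj-irrefl G₁ u | eqb-refl u | adj-irrefl G₂ v = refl

composition : ∀ {n₁ n₂} → Graph n₁ → Graph n₂ → Graph (n₁ * n₂)
composition {n₁} {n₂} G₁ G₂ = record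
  { adj = λ x y → compAdj G₁ G₂ (remQuot n₂ x) (remQuot n₂ y)
  ; adj-sym = λ x y → compAdj-sym G₁ G₂ (remQuot n₂ x) (remQuot n₂ y)
  ; adj-irrefl = λ x → compAdj-irrefl G₁ G₂ (remQuot n₂ x)
  }

_[_] : ∀ {n₁ n₂} → Graph n₁ → Graph n₂ → Graph (n₁ * n₂)
G₁ [ G₂ ] = composition G₁ G₂

-- In G₁[G₂] the vertex (u , v) sees the whole fibre over every G₁-neighbour of u, plus the
-- G₂-neighbours of v inside its own fibre. Hence degrees are n₂ k₁ + k₂; two non-adjacent
-- vertices in one fibre have n₂ k₁ + μ₂ common neighbours, and two in non-adjacent fibres have
-- n₂ μ₁. Both kinds of pairs occur when neither factor is complete, so pseudo strong regularity
-- forces n₂ k₁ + μ₂ = n₂ μ₁; as μ₁ ≤ k₁ this means μ₁ = k₁ and μ₂ = 0, and conversely then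
-- both counts equal n₂ k₁.
module Submission where

open import Defs
open import Data.Nat using (ℕ; zero; suc; _+_; _*_; _≤_; z≤n; s≤s; NonZero)
open import Data.Nat.Properties hiding (_≟_)
open import Data.Bool using (Bool; true; false; _∧_; _∨_; if_then_else_)
open import Data.Bool.Properties using (∨-identityʳ; ∧-zeroʳ)
open import Data.Fin using (Fin; remQuot; combine; _≟_; _↑ˡ_; _↑ʳ_)
import Data.Fin as Fin
open import Data.Fin.Properties using (remQuot-combine; combine-remQuot; nonZeroIndex)
open import Data.Empty using (⊥-elim)
open import Data.Product using (_×_; _,_; proj₁; proj₂; uncurry)
open import Function.Base using (_∘_; case_of_)
open import Function.Bundles using (_⇔_; mk⇔)
open import Relation.Nullary using (yes; no)
open import Relation.Nullary.Decidable using (⌊_⌋; isYes≗does; dec-true; dec-false)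
open import Relation.Binary.PropositionalEquality
  using (_≡_; _≢_; _≗_; refl; sym; trans; cong; cong₂; subst; subst₂; module ≡-Reasoning)
open import Algebra.Properties.Semiring.Sum +-*-semiring
  using (sum-syntax; sum-cong-≗; ∑-distrib-+; *-distribˡ-sum)

count-cong : ∀ {n} {f g : Fin n → Bool} → f ≗ g → count f ≡ count g
count-cong {zero}  f≗g = refl
count-cong {suc n} f≗g =
  cong₂ _+_ (cong (λ b → if b then 1 else 0) (f≗g Fin.zero)) (count-cong (f≗g ∘ Fin.suc))

count-const : ∀ n b → count {n} (λ _ → b) ≡ (if b then n else 0)
count-const zero    true  = refl
count-const zero    false = refl
count-const (suc n) true  = cong suc (count-const n true)
count-const (suc n) false = count-const n false

count-∧-≤ˡ : ∀ {n} (f g : Fin n → Bool) → count (λ i → f i ∧ g i) ≤ count f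
count-∧-≤ˡ {zero}  f g = z≤n
count-∧-≤ˡ {suc n} f g with f Fin.zero | g Fin.zero
... | true  | true  = s≤s (count-∧-≤ˡ (f ∘ Fin.suc) (g ∘ Fin.suc))
... | true  | false = m≤n⇒m≤1+n (count-∧-≤ˡ (f ∘ Fin.suc) (g ∘ Fin.suc))
... | false | _     = count-∧-≤ˡ (f ∘ Fin.suc) (g ∘ Fin.suc)

⌊≟⌋-true : ∀ {n} {u w : Fin n} → u ≡ w → ⌊ u ≟ w ⌋ ≡ true
⌊≟⌋-true {u = u} {w} u≡w = trans (isYes≗does (u ≟ w)) (dec-true (u ≟ w) u≡w)

⌊≟⌋-false : ∀ {n} {u w : Fin n} → u ≢ w → ⌊ u ≟ w ⌋ ≡ false
⌊≟⌋-false {u = u} {w} u≢w = trans (isYes≗does (u ≟ w)) (dec-false (u ≟ w) u≢w)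

count-≟ : ∀ {n} (u : Fin n) → count (λ w → ⌊ u ≟ w ⌋) ≡ 1
count-≟ {suc n} Fin.zero    = cong suc (count-const n false)
count-≟ {suc n} (Fin.suc u) = trans (count-cong suc≟suc) (count-≟ u)
  where
  suc≟suc : ∀ w → ⌊ Fin.suc u ≟ Fin.suc w ⌋ ≡ ⌊ u ≟ w ⌋
  suc≟suc w with u ≟ w
  ... | yes _ = refl
  ... | no  _ = refl

count≡∑ : ∀ {n} (f : Fin n → Bool) → count f ≡ ∑[ i < n ] (if f i then 1 else 0)
count≡∑ {zero}  f = refl
count≡∑ {suc n} f = cong ((if f Fin.zero then 1 else 0) +_) (count≡∑ (f ∘ Fin.suc))

∑-if : ∀ {n} (b : Fin n → Bool) c → ∑[ i < n ] (if b i then c else 0) ≡ c * count b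
∑-if {n} b c = begin
  ∑[ i < n ] (if b i then c else 0)        ≡⟨ sum-cong-≗ (scale ∘ b) ⟩
  ∑[ i < n ] (c * (if b i then 1 else 0))  ≡⟨ *-distribˡ-sum c (λ i → if b i then 1 else 0) ⟨
  c * ∑[ i < n ] (if b i then 1 else 0)    ≡⟨ cong (c *_) (count≡∑ b) ⟨
  c * count b                              ∎
  where
  open ≡-Reasoning
  scale : ∀ x → (if x then c else 0) ≡ c * (if x then 1 else 0)
  scale true  = sym (*-identityʳ c)
  scale false = sym (*-zeroʳ c)

∑-if-≟ : ∀ {n} (u : Fin n) c → ∑[ w < n ] (if ⌊ u ≟ w ⌋ then c else 0) ≡ c
∑-if-≟ u c = trans (∑-if (λ w → ⌊ u ≟ w ⌋) c) (trans (cong (c *_) (count-≟ u)) (*-identityʳ c))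

count-↑ : ∀ m {n} (f : Fin (m + n) → Bool) → count f ≡ count (f ∘ (_↑ˡ n)) + count (f ∘ (m ↑ʳ_))
count-↑ zero    f = refl
count-↑ (suc m) f =
  trans (cong (head +_) (count-↑ m (f ∘ Fin.suc))) (sym (+-assoc head _ _))
  where head = if f Fin.zero then 1 else 0

count-combine : ∀ m n (f : Fin (m * n) → Bool) → count f ≡ ∑[ i < m ] count (λ j → f (combine i j))
count-combine zero    n f = refl
count-combine (suc m) n f =
  trans (count-↑ n f) (cong (count (f ∘ (_↑ˡ m * n)) +_) (count-combine m n (f ∘ (n ↑ʳ_))))

count-remQuot : ∀ m n (g : Fin m × Fin n → Bool) →
  count (g ∘ remQuot {m} n) ≡ ∑[ i < m ] count (λ j → g (i , j))
count-remQuot m n g = trans (count-combine m n (g ∘ remQuot {m} n))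
  (sum-cong-≗ (λ i → count-cong (λ j → cong g (remQuot-combine i j))))

count-∨-∧ : ∀ {n} a e (f : Fin n → Bool) → (a ≡ true → e ≡ false) →
  count (λ z → a ∨ (e ∧ f z)) ≡ (if a then n else 0) + (if e then count f else 0)
count-∨-∧ {n} true  false f _    = trans (count-const n true) (sym (+-identityʳ n))
count-∨-∧     true  true  f excl with () ← excl refl
count-∨-∧     false true  f _    = refl
count-∨-∧ {n} false false f _    = count-const n false

∨-∧-factor : ∀ a e f g → (a ∨ (e ∧ f)) ∧ (a ∨ (e ∧ g)) ≡ a ∨ (e ∧ (f ∧ g))
∨-∧-factor true  _     _ _ = refl
∨-∧-factor false true  _ _ = refl
∨-∧-factor false false _ _ = refl

n*k+d≡n*l⇒l≡k∧d≡0 : ∀ n .{{_ : NonZero n}} {k l d} → n * k + d ≡ n * l → l ≤ k → l ≡ k × d ≡ 0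
n*k+d≡n*l⇒l≡k∧d≡0 n {k} {l} {d} eq l≤k = l≡k , d≡0
  where
  n*l≡n*k : n * l ≡ n * k
  n*l≡n*k = ≤-antisym (*-monoʳ-≤ n l≤k) (≤-trans (m≤m+n (n * k) d) (≤-reflexive eq))
  l≡k : l ≡ k
  l≡k = *-cancelˡ-≡ l k n n*l≡n*k
  d≡0 : d ≡ 0
  d≡0 = +-cancelˡ-≡ (n * k) d 0 (trans eq (trans n*l≡n*k (sym (+-identityʳ (n * k)))))

module _ {n} (G : Graph n) where

  commonNeighbours≤degree : ∀ u v → commonNeighbours G u v ≤ degree G u
  commonNeighbours≤degree u v = count-∧-≤ˡ (adj G u) (adj G v)

  adj⇒≢ : ∀ u w → adj G u w ≡ true → ⌊ u ≟ w ⌋ ≡ false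
  adj⇒≢ u w uw = ⌊≟⌋-false λ { refl → case trans (sym uw) (adj-irrefl G u) of λ () }

  count-fibres : ∀ {m} u (f : Fin m → Bool) →
    count (λ x → let (w , z) = remQuot {n} m x in adj G u w ∨ (⌊ u ≟ w ⌋ ∧ f z))
      ≡ m * degree G u + count f
  count-fibres {m} u f = begin
    count (λ x → let (w , z) = remQuot {n} m x in adj G u w ∨ (⌊ u ≟ w ⌋ ∧ f z))
      ≡⟨ count-remQuot n m _ ⟩
    ∑[ w < n ] count (λ z → adj G u w ∨ (⌊ u ≟ w ⌋ ∧ f z))
      ≡⟨ sum-cong-≗ (λ w → count-∨-∧ (adj G u w) _ f (adj⇒≢ u w)) ⟩
    ∑[ w < n ] ((if adj G u w then m else 0) + (if ⌊ u ≟ w ⌋ then count f else 0))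
      ≡⟨ ∑-distrib-+ (λ w → if adj G u w then m else 0) (λ w → if ⌊ u ≟ w ⌋ then count f else 0) ⟩
    ∑[ w < n ] (if adj G u w then m else 0) + ∑[ w < n ] (if ⌊ u ≟ w ⌋ then count f else 0)
      ≡⟨ cong₂ _+_ (∑-if (adj G u) m) (∑-if-≟ u (count f)) ⟩
    m * degree G u + count f ∎
    where open ≡-Reasoning

remQuot-injective : ∀ {m} n {x y : Fin (m * n)} → remQuot {m} n x ≡ remQuot n y → x ≡ y
remQuot-injective {m} n {x} {y} eq =
  trans (sym (combine-remQuot {m} n x)) (trans (cong (uncurry combine) eq) (combine-remQuot {m} n y))

module Composition {n₁ n₂} (G₁ : Graph n₁) (G₂ : Graph n₂) where

  -- adj (G₁ [ G₂ ]) x y unfolds to remQuot n₂ x ∼ remQuot n₂ y.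
  infix 5 _∼_
  _∼_ : Fin n₁ × Fin n₂ → Fin n₁ × Fin n₂ → Bool
  (u₁ , v₁) ∼ (u₂ , v₂) = adj G₁ u₁ u₂ ∨ (⌊ u₁ ≟ u₂ ⌋ ∧ adj G₂ v₁ v₂)

  commonNeighboursᵖ : Fin n₁ × Fin n₂ → Fin n₁ × Fin n₂ → ℕ
  commonNeighboursᵖ p q = count (λ x → (p ∼ remQuot n₂ x) ∧ (q ∼ remQuot n₂ x))

  ∼-sameFibre : ∀ u v₁ v₂ → (u , v₁) ∼ (u , v₂) ≡ adj G₂ v₁ v₂
  ∼-sameFibre u v₁ v₂ =
    cong₂ _∨_ (adj-irrefl G₁ u) (cong (_∧ adj G₂ v₁ v₂) (⌊≟⌋-true refl))

  ∼-distinctFibres : ∀ {u₁ u₂} v₁ v₂ → u₁ ≢ u₂ → (u₁ , v₁) ∼ (u₂ , v₂) ≡ adj G₁ u₁ u₂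
  ∼-distinctFibres {u₁} {u₂} v₁ v₂ u₁≢u₂ =
    trans (cong (λ b → adj G₁ u₁ u₂ ∨ (b ∧ adj G₂ v₁ v₂)) (⌊≟⌋-false u₁≢u₂))
          (∨-identityʳ (adj G₁ u₁ u₂))

  degree-composition : ∀ x → let (u , v) = remQuot {n₁} n₂ x in
    degree (G₁ [ G₂ ]) x ≡ n₂ * degree G₁ u + degree G₂ v
  degree-composition x = count-fibres G₁ (proj₁ (remQuot {n₁} n₂ x)) (adj G₂ (proj₂ (remQuot {n₁} n₂ x)))

  commonNeighboursᵖ-sameFibre : ∀ u v₁ v₂ →
    commonNeighboursᵖ (u , v₁) (u , v₂) ≡ n₂ * degree G₁ u + commonNeighbours G₂ v₁ v₂
  commonNeighboursᵖ-sameFibre u v₁ v₂ =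
    trans (count-cong (λ x → let (w , z) = remQuot {n₁} n₂ x in
                             ∨-∧-factor (adj G₁ u w) ⌊ u ≟ w ⌋ (adj G₂ v₁ z) (adj G₂ v₂ z)))
          (count-fibres G₁ u (λ z → adj G₂ v₁ z ∧ adj G₂ v₂ z))

  commonNeighboursᵖ-distinctFibres : ∀ {u₁ u₂} v₁ v₂ → u₁ ≢ u₂ → adj G₁ u₁ u₂ ≡ false →
    commonNeighboursᵖ (u₁ , v₁) (u₂ , v₂) ≡ n₂ * commonNeighbours G₁ u₁ u₂
  commonNeighboursᵖ-distinctFibres {u₁} {u₂} v₁ v₂ u₁≢u₂ u₁≁u₂ =
    trans (count-cong (λ x → onFibre (proj₁ (remQuot {n₁} n₂ x)) (proj₂ (remQuot {n₁} n₂ x))))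
          (trans (count-remQuot n₁ n₂ (λ (w , _) → adj G₁ u₁ w ∧ adj G₁ u₂ w))
                 (trans (sum-cong-≗ (λ w → count-const n₂ (adj G₁ u₁ w ∧ adj G₁ u₂ w)))
                        (∑-if (λ w → adj G₁ u₁ w ∧ adj G₁ u₂ w) n₂)))
    where
    u₂≁u₁ : adj G₁ u₂ u₁ ≡ false
    u₂≁u₁ = trans (adj-sym G₁ u₂ u₁) u₁≁u₂
    onFibre : ∀ w z → ((u₁ , v₁) ∼ (w , z)) ∧ ((u₂ , v₂) ∼ (w , z)) ≡ adj G₁ u₁ w ∧ adj G₁ u₂ w
    onFibre w z with u₁ ≟ w | u₂ ≟ w
    ... | yes refl | yes refl = ⊥-elim (u₁≢u₂ refl)
    ... | yes refl | no  _    rewrite adj-irrefl G₁ u₁ | u₂≁u₁ = ∧-zeroʳ (adj G₂ v₁ z)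
    ... | no  _    | yes refl rewrite adj-irrefl G₁ u₂ | u₁≁u₂ = refl
    ... | no  _    | no  _    = cong₂ _∧_ (∨-identityʳ (adj G₁ u₁ w)) (∨-identityʳ (adj G₁ u₂ w))

  commonNeighbours-fromPairs : ∀ {μ} →
    (∀ p q → p ≢ q → p ∼ q ≡ false → commonNeighboursᵖ p q ≡ μ) →
    ∀ x y → x ≢ y → adj (G₁ [ G₂ ]) x y ≡ false → commonNeighbours (G₁ [ G₂ ]) x y ≡ μ
  commonNeighbours-fromPairs nonAdjacent x y x≢y =
    nonAdjacent (remQuot n₂ x) (remQuot n₂ y) (x≢y ∘ remQuot-injective n₂)

  commonNeighbours-toPairs : ∀ {μ} →
    (∀ x y → x ≢ y → adj (G₁ [ G₂ ]) x y ≡ false → commonNeighbours (G₁ [ G₂ ]) x y ≡ μ) →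
    ∀ p q → p ≢ q → p ∼ q ≡ false → commonNeighboursᵖ p q ≡ μ
  commonNeighbours-toPairs {μ} nonAdjacent (u₁ , v₁) (u₂ , v₂) p≢q p≁q =
    subst (_≡ μ) (cong₂ commonNeighboursᵖ rq₁ rq₂)
      (nonAdjacent (combine u₁ v₁) (combine u₂ v₂)
        (λ x≡y → p≢q (trans (sym rq₁) (trans (cong (remQuot n₂) x≡y) rq₂)))
        (trans (cong₂ _∼_ rq₁ rq₂) p≁q))
    where
    rq₁ = remQuot-combine u₁ v₁
    rq₂ = remQuot-combine u₂ v₂

  module _ {k₁ μ₁ k₂ μ₂} (psr₁ : IsPSR G₁ k₁ μ₁) (psr₂ : IsPSR G₂ k₂ μ₂) where

    nonAdjacent-sameFibre : ∀ u {v₁ v₂} → v₁ ≢ v₂ → adj G₂ v₁ v₂ ≡ false →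
      commonNeighboursᵖ (u , v₁) (u , v₂) ≡ n₂ * k₁ + μ₂
    nonAdjacent-sameFibre u {v₁} {v₂} v₁≢v₂ v₁≁v₂ =
      trans (commonNeighboursᵖ-sameFibre u v₁ v₂)
            (cong₂ (λ d c → n₂ * d + c) (proj₁ psr₁ u) (proj₂ psr₂ v₁ v₂ v₁≢v₂ v₁≁v₂))

    nonAdjacent-distinctFibres : ∀ {u₁ u₂} v₁ v₂ → u₁ ≢ u₂ → adj G₁ u₁ u₂ ≡ false →
      commonNeighboursᵖ (u₁ , v₁) (u₂ , v₂) ≡ n₂ * μ₁
    nonAdjacent-distinctFibres {u₁} {u₂} v₁ v₂ u₁≢u₂ u₁≁u₂ =
      trans (commonNeighboursᵖ-distinctFibres v₁ v₂ u₁≢u₂ u₁≁u₂)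
            (cong (n₂ *_) (proj₂ psr₁ u₁ u₂ u₁≢u₂ u₁≁u₂))

    IsPSR-composition⇒ : ∀ {k μ} → NonComplete G₁ → NonComplete G₂ →
      IsPSR (G₁ [ G₂ ]) k μ → μ₁ ≡ k₁ × μ₂ ≡ 0
    IsPSR-composition⇒ {μ = μ} (u₁ , u₂ , u₁≢u₂ , u₁≁u₂) (v₁ , v₂ , v₁≢v₂ , v₁≁v₂) (_ , cn≡μ) =
      n*k+d≡n*l⇒l≡k∧d≡0 n₂ {{nonZeroIndex v₁}} (trans sameFibre≡μ (sym distinctFibres≡μ)) μ₁≤k₁
      where
      cnᵖ≡μ = commonNeighbours-toPairs cn≡μ
      sameFibre≡μ : n₂ * k₁ + μ₂ ≡ μ
      sameFibre≡μ = trans (sym (nonAdjacent-sameFibre u₁ v₁≢v₂ v₁≁v₂))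
        (cnᵖ≡μ _ _ (v₁≢v₂ ∘ cong proj₂) (trans (∼-sameFibre u₁ v₁ v₂) v₁≁v₂))
      distinctFibres≡μ : n₂ * μ₁ ≡ μ
      distinctFibres≡μ = trans (sym (nonAdjacent-distinctFibres v₁ v₁ u₁≢u₂ u₁≁u₂))
        (cnᵖ≡μ _ _ (u₁≢u₂ ∘ cong proj₁) (trans (∼-distinctFibres v₁ v₁ u₁≢u₂) u₁≁u₂))
      μ₁≤k₁ : μ₁ ≤ k₁
      μ₁≤k₁ = subst₂ _≤_ (proj₂ psr₁ u₁ u₂ u₁≢u₂ u₁≁u₂) (proj₁ psr₁ u₁)
                         (commonNeighbours≤degree G₁ u₁ u₂)

  IsPSR-composition : ∀ {k₁ k₂} → IsPSR G₁ k₁ k₁ → IsPSR G₂ k₂ 0 →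
    IsPSR (G₁ [ G₂ ]) (n₂ * k₁ + k₂) (n₂ * k₁)
  IsPSR-composition {k₁} {k₂} psr₁ psr₂ = regular , commonNeighbours-fromPairs nonAdjacent
    where
    regular : ∀ x → degree (G₁ [ G₂ ]) x ≡ n₂ * k₁ + k₂
    regular x = trans (degree-composition x) (cong₂ (λ d e → n₂ * d + e) (proj₁ psr₁ _) (proj₁ psr₂ _))
    nonAdjacent : ∀ p q → p ≢ q → p ∼ q ≡ false → commonNeighboursᵖ p q ≡ n₂ * k₁
    nonAdjacent (u₁ , v₁) (u₂ , v₂) p≢q p≁q with u₁ ≟ u₂
    ... | yes refl = trans (nonAdjacent-sameFibre psr₁ psr₂ u₁ (p≢q ∘ cong (u₁ ,_))
                                 (trans (cong (_∨ adj G₂ v₁ v₂) (sym (adj-irrefl G₁ u₁))) p≁q))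
                           (+-identityʳ (n₂ * k₁))
    ... | no u₁≢u₂ = nonAdjacent-distinctFibres psr₁ psr₂ v₁ v₂ u₁≢u₂
                       (trans (sym (∨-identityʳ (adj G₁ u₁ u₂))) p≁q)

mainTheorem4 : ∀ {n₁ n₂} (G₁ : Graph n₁) (G₂ : Graph n₂) (k₁ μ₁ k₂ μ₂ : ℕ) →
    NonComplete G₁ → NonComplete G₂ →
    IsPSR G₁ k₁ μ₁ → IsPSR G₂ k₂ μ₂ →
    (IsPSRGraph (G₁ [ G₂ ]) ⇔ (μ₁ ≡ k₁ × μ₂ ≡ 0))
mainTheorem4 G₁ G₂ k₁ μ₁ k₂ μ₂ nonComplete₁ nonComplete₂ psr₁ psr₂ = mk⇔
  (λ (_ , _ , psr) → IsPSR-composition⇒ psr₁ psr₂ nonComplete₁ nonComplete₂ psr)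
  (λ (μ₁≡k₁ , μ₂≡0) → _ , _ , IsPSR-composition (subst (IsPSR G₁ k₁) μ₁≡k₁ psr₁)
                                                 (subst (IsPSR G₂ k₂) μ₂≡0 psr₂))
  where open Composition G₁ G₂
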